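{- The property of being a maximal Roman dominating function is a nice Roman domination property.
   Context: Graphs are finite, simple and undirected. $N(v)$, $N[v]=N(v)\cup\{v\}$ are open/closed neighborhoods, $N[A]=\bigcup_{v\in A}N[v]$. For $A\subseteq V$ and $v\in A$, $P_{H,A}(v)=N_H[v]\setminus N_H[A\setminus\{v\}]$ in a graph $H$. For $f:V\to\{0,1,2\}$, $V_i(f)=\{v: f(v)=i\}$; $\chi_S$ is the characteristic function of $S$. A Roman dominating function (Rdf) is an $f:V\to\{0,1,2\}$ such that each $v\in V_0(f)$ has a neighbor in $V_2(f)$. A maximal Roman dominating function is an Rdf $f$ with $N[V_0(f)]\ne V$. A property $\mathcal{P}$ assigns to each graph a set of functions $V\to\{0,1,2\}$. $\mathcal{P}$ is a nice Roman domination property if for every graph $G=(V,E)$ and every $f$ with property $\mathcal{P}$: (1) $f$ is an Rdf; (2) for all $v\in V_0(f)$, $f+\chi_{\{v\}}$ has $\mathcal{P}$; (3) for all $v\in V_2(f)$, $f-\chi_{\{v\}}$ has $\mathcal{P}$ iff $P_{G[V\setminus V_1(f)],V_2(f)}(v)\subseteq\{v\}$. -}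

module Defs where

open import Data.Nat using (ℕ)
open import Data.Fin using (Fin)
open import Data.Bool using (Bool; true; false; T)
open import Data.Product using (_×_; ∃-syntax; _,_)
open import Data.Sum using (_⊎_)
open import Relation.Nullary using (¬_)
open import Relation.Binary.PropositionalEquality using (_≡_; _≢_)
open import Relation.Nullary.Decidable using (⌊_⌋)
open import Data.Fin using (_≟_)
open import Function.Bundles using (_⇔_)

record Graph (n : ℕ) : Set where
  field
    adj    : Fin n → Fin n → Bool
    sym    : ∀ u v → adj u v ≡ adj v u
    irrefl : ∀ v → adj v v ≡ false

open Graph public

Adj : ∀ {n} → Graph n → Fin n → Fin n → Set
Adj G u v = T (adj G u v)

data Val : Set where
  v0 v1 v2 : Val

RFun : ℕ → Set
RFun n = Fin n → Val

InN : ∀ {n} → Graph n → Fin n → Fin n → Set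
InN G v u = (u ≡ v) ⊎ Adj G v u

IsRdf : ∀ {n} → Graph n → RFun n → Set
IsRdf G f = ∀ v → f v ≡ v0 → ∃[ w ] (Adj G v w × f w ≡ v2)

InNV0 : ∀ {n} → Graph n → RFun n → Fin n → Set
InNV0 G f u = ∃[ w ] (f w ≡ v0 × InN G w u)

IsMaxRdf : ∀ {n} → Graph n → RFun n → Set
IsMaxRdf G f = IsRdf G f × ¬ (∀ u → InNV0 G f u)

-- pointwise update f[v ↦ a]  (f + χ_{v} for f v = 0 gives a = 1;
-- f - χ_{v} for f v = 2 gives a = 1)
update : ∀ {n} → RFun n → Fin n → Val → RFun n
update f v a u with ⌊ u ≟ v ⌋
... | true  = a
... | false = f u

InNInd : ∀ {n} → Graph n → (Fin n → Set) → Fin n → Fin n → Set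
InNInd G S v u = S v × S u × InN G v u

InPriv : ∀ {n} → Graph n → (Fin n → Set) → (Fin n → Set) → Fin n → Fin n → Set
InPriv G S A v u =
  InNInd G S v u × (∀ w → A w → w ≢ v → ¬ InNInd G S w u)

NotV1 : ∀ {n} → RFun n → Fin n → Set
NotV1 f u = ¬ (f u ≡ v1)

InV2 : ∀ {n} → RFun n → Fin n → Set
InV2 f u = f u ≡ v2

Property : Set₁
Property = ∀ {n} → Graph n → RFun n → Set

IsNice : Property → Set
IsNice P = ∀ {n} (G : Graph n) (f : RFun n) → P G f →
    IsRdf G f
  × (∀ v → f v ≡ v0 → P G (update f v v1))
  × (∀ v → f v ≡ v2 →
       (P G (update f v v1) ⇔
        (∀ u → InPriv G (NotV1 f) (InV2 f) v u → u ≡ v)))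

-- Raising a 0 to 1 or lowering a 2 to 1 only shrinks V₀(f), so the condition
-- N[V₀(f)] ≠ V survives both moves, and everything reduces to the Rdf property.
-- Raising a 0 keeps every 2, so the result is still an Rdf.  Lowering a 2 at v
-- yields an Rdf exactly when every 0-vertex has a 2-neighbour other than v, and a
-- 0-vertex violating this is precisely a private neighbour u ≠ v of v in
-- G[V ∖ V₁(f)] with respect to V₂(f).
module Submission where

open import Defs
open import Data.Nat using (ℕ)
open import Data.Fin using (Fin; _≟_)
open import Data.Fin.Properties using (any?)
open import Data.Bool using (T)
open import Data.Bool.Properties using (T?)
open import Data.Product using (_×_; ∃-syntax; _,_; proj₂)
open import Data.Sum using (inj₁; inj₂)
open import Data.Empty using (⊥; ⊥-elim)
open import Relation.Nullary using (¬_; Dec; yes; no; contradiction)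
open import Relation.Nullary.Decidable using (_×-dec_; ¬?)
open import Relation.Binary.PropositionalEquality
  using (_≡_; _≢_; refl; trans; subst)
open import Function.Bundles using (_⇔_; mk⇔)

_≟v2 : (a : Val) → Dec (a ≡ v2)
v0 ≟v2 = no λ ()
v1 ≟v2 = no λ ()
v2 ≟v2 = yes refl

≡v0⇒≢v1 : ∀ {a} → a ≡ v0 → a ≢ v1
≡v0⇒≢v1 refl ()

≡v2⇒≢v0 : ∀ {a} → a ≡ v2 → a ≢ v0
≡v2⇒≢v0 refl ()

≡v2⇒≢v1 : ∀ {a} → a ≡ v2 → a ≢ v1
≡v2⇒≢v1 refl ()

adj-sym : ∀ {n} (G : Graph n) {u w} → Adj G u w → Adj G w u
adj-sym G {u} {w} = subst T (sym G u w)

adj⇒≢ : ∀ {n} (G : Graph n) {u w} → Adj G u w → w ≢ u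
adj⇒≢ G {u} u∼u refl = subst T (irrefl G u) u∼u

module _ {n : ℕ} (f : RFun n) (v : Fin n) (a : Val) where

  update-other : ∀ {u} → u ≢ v → update f v a u ≡ f u
  update-other {u} u≢v with u ≟ v
  ... | yes u≡v = contradiction u≡v u≢v
  ... | no _ = refl

  update-preimage : ∀ {u b} → a ≢ b → update f v a u ≡ b → u ≢ v × f u ≡ b
  update-preimage {u} a≢b fu≡b with u ≟ v
  ... | yes _ = ⊥-elim (a≢b fu≡b)
  ... | no u≢v = u≢v , fu≡b

InNV0-update-v1 : ∀ {n} (G : Graph n) f v {u} →
  InNV0 G (update f v v1) u → InNV0 G f u
InNV0-update-v1 G f v (w , fw≡v0 , w∼u) =
  w , proj₂ (update-preimage f v v1 (λ ()) fw≡v0) , w∼u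

uncovered-update-v1 : ∀ {n} (G : Graph n) f v →
  ¬ (∀ u → InNV0 G f u) → ¬ (∀ u → InNV0 G (update f v v1) u)
uncovered-update-v1 G f v uncovered covered =
  uncovered λ u → InNV0-update-v1 G f v (covered u)

DominatedAvoiding : ∀ {n} → Graph n → RFun n → Fin n → Set
DominatedAvoiding G f v = ∀ u → f u ≡ v0 → ∃[ w ] (Adj G u w × f w ≡ v2 × w ≢ v)

module _ {n : ℕ} (G : Graph n) (f : RFun n) (v : Fin n) where

  isRdf⇒dominatedAvoiding-zero : IsRdf G f → f v ≡ v0 → DominatedAvoiding G f v
  isRdf⇒dominatedAvoiding-zero rdf fv≡v0 u fu≡v0 with rdf u fu≡v0
  ... | w , u∼w , fw≡v2 = w , u∼w , fw≡v2 , λ { refl → ≡v2⇒≢v0 fw≡v2 fv≡v0 }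

  dominatedAvoiding⇒isRdf-update-v1 : DominatedAvoiding G f v → IsRdf G (update f v v1)
  dominatedAvoiding⇒isRdf-update-v1 dom u gu≡v0
    with dom u (proj₂ (update-preimage f v v1 (λ ()) gu≡v0))
  ... | w , u∼w , fw≡v2 , w≢v = w , u∼w , trans (update-other f v v1 w≢v) fw≡v2

  isRdf-update-v1⇒dominatedAvoiding :
    f v ≢ v0 → IsRdf G (update f v v1) → DominatedAvoiding G f v
  isRdf-update-v1⇒dominatedAvoiding fv≢v0 rdf u fu≡v0 =
    let w , u∼w , gw≡v2 = rdf u (trans (update-other f v v1 (λ { refl → fv≢v0 fu≡v0 })) fu≡v0)
        w≢v , fw≡v2     = update-preimage f v v1 (λ ()) gw≡v2
    in  w , u∼w , fw≡v2 , w≢v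

  dominatedAvoiding⇒private⊆self :
    DominatedAvoiding G f v → ∀ u → InPriv G (NotV1 f) (InV2 f) v u → u ≡ v
  dominatedAvoiding⇒private⊆self dom u ((_ , _ , inj₁ u≡v) , _) = u≡v
  dominatedAvoiding⇒private⊆self dom u ((_ , u∉V₁ , inj₂ v∼u) , excl) =
    ⊥-elim (refute (f u) refl)
    where
    refute : ∀ a → f u ≡ a → ⊥
    refute v0 fu≡v0 = let w , u∼w , fw≡v2 , w≢v = dom u fu≡v0 in
      excl w fw≡v2 w≢v (≡v2⇒≢v1 fw≡v2 , u∉V₁ , inj₂ (adj-sym G u∼w))
    refute v1 fu≡v1 = u∉V₁ fu≡v1
    refute v2 fu≡v2 = excl u fu≡v2 (adj⇒≢ G v∼u) (u∉V₁ , u∉V₁ , inj₁ refl)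

  private⊆self⇒dominatedAvoiding : IsRdf G f → f v ≡ v2 →
    (∀ u → InPriv G (NotV1 f) (InV2 f) v u → u ≡ v) → DominatedAvoiding G f v
  private⊆self⇒dominatedAvoiding rdf fv≡v2 private⊆self u fu≡v0
    with any? (λ x → T? (adj G u x) ×-dec ((f x ≟v2) ×-dec ¬? (x ≟ v)))
  ... | yes found = found
  ... | no none =
    contradiction (private⊆self u ((≡v2⇒≢v1 fv≡v2 , u∉V₁ , inj₂ v∼u) , excl)) u≢v
    where
    u∉V₁ : f u ≢ v1
    u∉V₁ = ≡v0⇒≢v1 fu≡v0

    u≢v : u ≢ v
    u≢v refl = ≡v2⇒≢v0 fv≡v2 fu≡v0

    v∼u : Adj G v u
    v∼u with rdf u fu≡v0
    ... | w , u∼w , fw≡v2 with w ≟ v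
    ...   | yes refl = adj-sym G u∼w
    ...   | no w≢v = contradiction (w , u∼w , fw≡v2 , w≢v) none

    excl : ∀ w → InV2 f w → w ≢ v → ¬ InNInd G (NotV1 f) w u
    excl w fw≡v2 w≢v (_ , _ , inj₁ refl) = ≡v2⇒≢v0 fw≡v2 fu≡v0
    excl w fw≡v2 w≢v (_ , _ , inj₂ w∼u) = none (w , adj-sym G w∼u , fw≡v2 , w≢v)

lemma5 : IsNice IsMaxRdf
lemma5 G f (rdf , uncovered) = rdf , raise , lower
  where
  uncovered′ : ∀ v → ¬ (∀ u → InNV0 G (update f v v1) u)
  uncovered′ v = uncovered-update-v1 G f v uncovered

  raise : ∀ v → f v ≡ v0 → IsMaxRdf G (update f v v1)
  raise v fv≡v0 =
    dominatedAvoiding⇒isRdf-update-v1 G f v (isRdf⇒dominatedAvoiding-zero G f v rdf fv≡v0)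
    , uncovered′ v

  lower : ∀ v → f v ≡ v2 → IsMaxRdf G (update f v v1) ⇔
          (∀ u → InPriv G (NotV1 f) (InV2 f) v u → u ≡ v)
  lower v fv≡v2 = mk⇔
    (λ (rdf′ , _) → dominatedAvoiding⇒private⊆self G f v
       (isRdf-update-v1⇒dominatedAvoiding G f v (≡v2⇒≢v0 fv≡v2) rdf′))
    (λ private⊆self → dominatedAvoiding⇒isRdf-update-v1 G f v
       (private⊆self⇒dominatedAvoiding G f v rdf fv≡v2 private⊆self)
       , uncovered′ v)
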